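{- Let $n\ge 1$, let $\pi=\pi_1\cdots\pi_n\in\mathcal S_n$ with $\pi_1=i$, and let $\pi'=\mathrm{red}(\pi_2\cdots\pi_n)\in\mathcal S_{n-1}$. Then $$\mathrm{weight}(\pi)=x_1x_2\cdots x_{i-1}\cdot\mathrm{weight}(\pi')\big|_A,$$ where $A$ is the simultaneous substitution $x_b\to y_i\,x_{b+1}$ and $y_b\to t\,y_{b+1}$ for all $i\le b\le n-1$, all other variables being left unchanged.
   Context: For a sequence $\sigma=\sigma_1\cdots\sigma_k$ of distinct positive integers, $\mathrm{red}(\sigma)$ is the unique $\tau\in\mathcal S_k$ order-isomorphic to $\sigma$. For $\pi\in\mathcal S_m$, $N_{1243}(\pi)$ is the number of index quadruples $a<b<c<d$ with $\mathrm{red}(\pi_a\pi_b\pi_c\pi_d)=1243$. Define, in the polynomial ring in $t,x_1,x_2,\dots,y_1,y_2,\dots$, $$\mathrm{weight}(\pi)=t^{N_{1243}(\pi)}\prod_{i=1}^{m}x_i^{\#\{(a,b):\,a<b,\ \pi_a>\pi_b=i\}}\;y_i^{\#\{(a,b,c):\,a<b<c,\ \pi_a=i<\pi_c<\pi_b\}},$$ where all indices range in $\{1,\dots,m\}$. -}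

module Defs where

open import Data.Nat using (ℕ; zero; suc; _+_; _∸_; _<_; _≤_; _<?_; _≤?_)
open import Data.Nat.Properties using (_≟_)
open import Data.Bool using (Bool; true; false; _∧_; if_then_else_)
open import Data.List using (List; []; _∷_; map; upTo; length; filter; concatMap; replicate; _++_)
open import Data.List.Properties using (≡-dec)
open import Data.List.Relation.Binary.Permutation.Propositional using (_↭_)
open import Relation.Nullary.Decidable using (⌊_⌋)
open import Relation.Binary.PropositionalEquality using (_≡_)
open import Data.Product using (_×_)

range1 : ℕ → List ℕ
range1 k = map suc (upTo k)

IsPerm : ℕ → List ℕ → Set
IsPerm m π = π ↭ range1 m

-- red(σ): replace each entry by its rank (1 + number of smaller entries);
-- for a sequence of distinct positive integers this is the unique
-- order-isomorphic permutation.
red : List ℕ → List ℕ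
red σ = map (λ v → suc (length (filter (λ w → w <? v) σ))) σ

-- 1-based lookup π_a (default 0 out of range)
at : List ℕ → ℕ → ℕ
at []       _             = 0
at (x ∷ xs) zero          = 0
at (x ∷ xs) (suc zero)    = x
at (x ∷ xs) (suc (suc a)) = at xs (suc a)

count : List Bool → ℕ
count [] = 0
count (true ∷ bs)  = suc (count bs)
count (false ∷ bs) = count bs

b< : ℕ → ℕ → Bool
b< a b = ⌊ a <? b ⌋

b≡ : ℕ → ℕ → Bool
b≡ a b = ⌊ a ≟ b ⌋

count2 : ℕ → (ℕ → ℕ → Bool) → ℕ
count2 m P = count (concatMap (λ a → map (λ b → b< a b ∧ P a b) (range1 m)) (range1 m))

count3 : ℕ → (ℕ → ℕ → ℕ → Bool) → ℕ
count3 m P = count (concatMap (λ a → concatMap (λ b → map (λ c →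
  b< a b ∧ b< b c ∧ P a b c) (range1 m)) (range1 m)) (range1 m))

count4 : ℕ → (ℕ → ℕ → ℕ → ℕ → Bool) → ℕ
count4 m P = count (concatMap (λ a → concatMap (λ b → concatMap (λ c → map (λ d →
  b< a b ∧ b< b c ∧ b< c d ∧ P a b c d) (range1 m)) (range1 m)) (range1 m)) (range1 m))

N1243 : ℕ → List ℕ → ℕ
N1243 m π = count4 m (λ a b c d →
  ⌊ ≡-dec _≟_ (red (at π a ∷ at π b ∷ at π c ∷ at π d ∷ [])) (1 ∷ 2 ∷ 4 ∷ 3 ∷ []) ⌋)

data Var : Set where
  T : Var
  X : ℕ → Var
  Y : ℕ → Var

-- a monomial is the multiset of its variable occurrences (a List Var);
-- two monomials are equal iff the lists are permutations of each other (_↭_),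
-- and multiplication of monomials is _++_.
Monomial : Set
Monomial = List Var

xExp : ℕ → List ℕ → ℕ → ℕ
xExp m π i = count2 m (λ a b → b< (at π b) (at π a) ∧ b≡ (at π b) i)

yExp : ℕ → List ℕ → ℕ → ℕ
yExp m π i = count3 m (λ a b c → b≡ (at π a) i ∧ b< i (at π c) ∧ b< (at π c) (at π b))

weight : ℕ → List ℕ → Monomial
weight m π = replicate (N1243 m π) T
          ++ concatMap (λ i → replicate (xExp m π i) (X i) ++ replicate (yExp m π i) (Y i)) (range1 m)

applySubst : (Var → Monomial) → Monomial → Monomial
applySubst σ = concatMap σ

inRange : ℕ → ℕ → ℕ → Bool
inRange n i b = ⌊ i ≤? b ⌋ ∧ ⌊ b ≤? n ∸ 1 ⌋

substA : ℕ → ℕ → Var → Monomial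
substA n i T     = T ∷ []
substA n i (X b) = if inRange n i b then Y i ∷ X (suc b) ∷ [] else X b ∷ []
substA n i (Y b) = if inRange n i b then T ∷ Y (suc b) ∷ [] else Y b ∷ []

-- Two monomials are equal exactly when they have the same degree under every weighting
-- h : Var → ℕ of the variables, and the degree of weight(w) is a sum over subsequences of w:
-- N₁₂₄₃(w)·h(t) + Σ h(x_b) over the inversions (a, b) + Σ h(y_a) over the 132-triples (a, b, c).
-- Write π = i ∷ rest; then rest = map (skip i) π', where skip i is the increasing map of ℕ onto
-- ℕ ∖ {i}.  A subsequence of π either avoids π₁ = i, and is then a subsequence of π' relabelled
-- by skip i, which accounts for the renaming x_b ↦ x_{b+1}, y_b ↦ y_{b+1} (b ≥ i) in A; or it
-- starts with i.  Those give the inversions (i, b) with b < i, that is x₁⋯x_{i−1}; one y_i for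
-- every inversion of π' with smaller entry b ≥ i, which A attaches to x_b; and one t for every
-- 132-triple of π' with smallest entry b ≥ i, which A attaches to y_b.

module Submission where

open import Defs
open import Data.Nat using (ℕ; _≤_; _∸_)
open import Data.List using (List; _∷_; _++_; map)
open import Data.List.Relation.Binary.Permutation.Propositional using (_↭_)

open import Data.Bool using (Bool; true; false; _∧_; if_then_else_)
open import Data.Bool.Properties using (∧-zeroʳ; ∧-comm; ∧-identityʳ)
open import Data.List using ([]; concatMap; replicate; upTo; applyUpTo; length; filter)
open import Data.List.Membership.Propositional using (_∈_)
open import Data.List.Membership.Propositional.Properties using (∈-∃++)
open import Data.List.Properties
  using ( map-upTo; map-∘; length-map; length-upTo; map-id-local; filter-notAll; ≡-dec
        ; ∷-injectiveˡ; ∷-injectiveʳ)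
open import Data.List.Relation.Binary.Permutation.Propositional
  using (↭-refl; ↭-prep; ↭-trans; ↭-sym; ↭⇒↭ₛ)
import Data.List.Relation.Binary.Permutation.Propositional.Properties as ↭ₚ
open ↭ₚ using (shift)
open import Data.List.Relation.Unary.All as All using (All; []; _∷_)
import Data.List.Relation.Unary.All.Properties as Allₚ
open import Data.List.Relation.Unary.AllPairs using (AllPairs; []; _∷_)
import Data.List.Relation.Unary.AllPairs.Properties as AllPairsₚ
import Data.List.Relation.Unary.Any as Any
open import Data.List.Relation.Unary.Any using (here; there)
open import Data.List.Relation.Unary.Unique.Propositional using (Unique)
import Data.List.Relation.Unary.Unique.Propositional.Properties as Uniqueₚ
open import Data.Nat using (suc; zero; _+_; _*_; _<_; _<ᵇ_; _≤ᵇ_; _≡ᵇ_; _<?_; _≤?_; z≤n; s≤s; s<s)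
open import Data.Nat.ListAction using (sum)
open import Data.Nat.ListAction.Properties using (sum-↭)
open import Data.Nat.Properties
open import Algebra.Properties.CommutativeSemigroup +-commutativeSemigroup using (interchange)
open import Data.Nat.Tactic.RingSolver using (solve-∀)
open import Data.Product using (_×_; _,_)
open import Data.Vec.N-ary using (N-ary; Eq)
open import Function using (id; _∘_; _⟨_⟩_)
open import Function.Bundles using (_⇔_; mk⇔; Equivalence)
open import Relation.Binary.Definitions using (DecidableEquality)
open import Relation.Binary.PropositionalEquality
import Data.List.Relation.Binary.Permutation.Setoid.Properties (setoid ℕ) as PermSetoid
open import Relation.Nullary using (Dec; contradiction; yes; no; does)
import Relation.Nullary.Decidable as Decidable
open import Relation.Nullary.Decidable using (isYes≗does; ⌊_⌋)
open import Relation.Nullary.Reflects using (ofʸ; ofⁿ)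

open ≡-Reasoning

private variable A B C : Set

-- Sums over subsequences

-- ∑ n F w is the sum of F x₁ ⋯ xₙ over the length-n subsequences x₁ ⋯ xₙ of w.
∑ : (n : ℕ) → N-ary n A ℕ → List A → ℕ
∑ zero    c w       = c
∑ (suc n) F []      = 0
∑ (suc n) F (x ∷ w) = ∑ n (F x) w + ∑ (suc n) F w

mapⁿ : ∀ n → (B → C) → N-ary n A B → N-ary n A C
mapⁿ zero    g c = g c
mapⁿ (suc n) g F = λ x → mapⁿ n g (F x)

zipWithⁿ : ∀ n → (ℕ → ℕ → ℕ) → N-ary n A ℕ → N-ary n A ℕ → N-ary n A ℕ
zipWithⁿ zero    _⊕_ a b = a ⊕ b
zipWithⁿ (suc n) _⊕_ F G = λ x → zipWithⁿ n _⊕_ (F x) (G x)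

_∘ⁿ_ : ∀ {n} → N-ary n B ℕ → (A → B) → N-ary n A ℕ
_∘ⁿ_ {n = zero}  c f = c
_∘ⁿ_ {n = suc n} F f = λ x → F (f x) ∘ⁿ f

∑ⁿ : ∀ n → List B → (B → N-ary n A ℕ) → N-ary n A ℕ
∑ⁿ zero    ks F = ∑ 1 F ks
∑ⁿ (suc n) ks F = λ x → ∑ⁿ n ks (λ k → F k x)

EqOn : ∀ n → (A → Set) → N-ary n A ℕ → N-ary n A ℕ → Set
EqOn zero    P a b = a ≡ b
EqOn (suc n) P F G = ∀ x → P x → EqOn n P (F x) (G x)

∑-cong : ∀ n {F G : N-ary n A ℕ} → Eq n _≡_ F G → ∀ w → ∑ n F w ≡ ∑ n G w
∑-cong zero    F≗G w       = F≗G
∑-cong (suc n) F≗G []      = refl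
∑-cong (suc n) F≗G (x ∷ w) = cong₂ _+_ (∑-cong n (F≗G x) w) (∑-cong (suc n) F≗G w)

∑-cong-local : ∀ n {P : A → Set} {F G : N-ary n A ℕ} → EqOn n P F G →
  ∀ {w} → All P w → ∑ n F w ≡ ∑ n G w
∑-cong-local zero    F≗G _         = F≗G
∑-cong-local (suc n) F≗G []        = refl
∑-cong-local (suc n) F≗G (px ∷ pw) =
  cong₂ _+_ (∑-cong-local n (F≗G _ px) pw) (∑-cong-local (suc n) F≗G pw)

∑-+ : ∀ n (F G : N-ary n A ℕ) w → ∑ n (zipWithⁿ n _+_ F G) w ≡ ∑ n F w + ∑ n G w
∑-+ zero    F G w       = refl
∑-+ (suc n) F G []      = refl
∑-+ (suc n) F G (x ∷ w) = begin
  ∑ n (zipWithⁿ n _+_ (F x) (G x)) w + ∑ (suc n) (zipWithⁿ (suc n) _+_ F G) w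
    ≡⟨ cong₂ _+_ (∑-+ n (F x) (G x) w) (∑-+ (suc n) F G w) ⟩
  (∑ n (F x) w + ∑ n (G x) w) + (∑ (suc n) F w + ∑ (suc n) G w)
    ≡⟨ interchange (∑ n (F x) w) _ _ _ ⟩
  (∑ n (F x) w + ∑ (suc n) F w) + (∑ n (G x) w + ∑ (suc n) G w) ∎

∑-*ʳ : ∀ n (F : N-ary n A ℕ) c w → ∑ n (mapⁿ n (_* c) F) w ≡ ∑ n F w * c
∑-*ʳ zero    F c w       = refl
∑-*ʳ (suc n) F c []      = refl
∑-*ʳ (suc n) F c (x ∷ w) = begin
  ∑ n (mapⁿ n (_* c) (F x)) w + ∑ (suc n) (mapⁿ (suc n) (_* c) F) w
    ≡⟨ cong₂ _+_ (∑-*ʳ n (F x) c w) (∑-*ʳ (suc n) F c w) ⟩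
  ∑ n (F x) w * c + ∑ (suc n) F w * c
    ≡⟨ *-distribʳ-+ c (∑ n (F x) w) _ ⟨
  (∑ n (F x) w + ∑ (suc n) F w) * c ∎

∑-map : ∀ n (F : N-ary n B ℕ) (f : A → B) w → ∑ n F (map f w) ≡ ∑ n (F ∘ⁿ f) w
∑-map zero    F f w       = refl
∑-map (suc n) F f []      = refl
∑-map (suc n) F f (x ∷ w) = cong₂ _+_ (∑-map n (F (f x)) f w) (∑-map (suc n) F f w)

∑₁-zero : ∀ (ks : List B) → ∑ 1 (λ _ → 0) ks ≡ 0
∑₁-zero []       = refl
∑₁-zero (k ∷ ks) = ∑₁-zero ks

∑-comm : ∀ n (F : B → N-ary n A ℕ) ks w → ∑ 1 (λ k → ∑ n (F k) w) ks ≡ ∑ n (∑ⁿ n ks F) w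
∑-comm zero    F ks w       = refl
∑-comm (suc n) F ks []      = ∑₁-zero ks
∑-comm (suc n) F ks (x ∷ w) = begin
  ∑ 1 (λ k → ∑ n (F k x) w + ∑ (suc n) (F k) w) ks
    ≡⟨ ∑-+ 1 (λ k → ∑ n (F k x) w) (λ k → ∑ (suc n) (F k) w) ks ⟩
  ∑ 1 (λ k → ∑ n (F k x) w) ks + ∑ 1 (λ k → ∑ (suc n) (F k) w) ks
    ≡⟨ cong₂ _+_ (∑-comm n (λ k → F k x) ks w) (∑-comm (suc n) F ks w) ⟩
  ∑ n (∑ⁿ n ks (λ k → F k x)) w + ∑ (suc n) (∑ⁿ (suc n) ks F) w ∎

∑₁-++ : ∀ (f : A → ℕ) xs ys → ∑ 1 f (xs ++ ys) ≡ ∑ 1 f xs + ∑ 1 f ys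
∑₁-++ f []       ys = refl
∑₁-++ f (x ∷ xs) ys = trans (cong (f x +_) (∑₁-++ f xs ys)) (sym (+-assoc (f x) _ _))

∑₁-concatMap : ∀ (f : B → ℕ) (g : A → List B) xs →
  ∑ 1 f (concatMap g xs) ≡ ∑ 1 (λ x → ∑ 1 f (g x)) xs
∑₁-concatMap f g []       = refl
∑₁-concatMap f g (x ∷ xs) =
  trans (∑₁-++ f (g x) (concatMap g xs)) (cong (∑ 1 f (g x) +_) (∑₁-concatMap f g xs))

∑₁-replicate : ∀ (f : A → ℕ) k x → ∑ 1 f (replicate k x) ≡ k * f x
∑₁-replicate f zero    x = refl
∑₁-replicate f (suc k) x = cong (f x +_) (∑₁-replicate f k x)

∑₁-sum : ∀ (f : A → ℕ) xs → ∑ 1 f xs ≡ sum (map f xs)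
∑₁-sum f []       = refl
∑₁-sum f (x ∷ xs) = cong (f x +_) (∑₁-sum f xs)

∑₁-↭ : ∀ (f : A → ℕ) {xs ys} → xs ↭ ys → ∑ 1 f xs ≡ ∑ 1 f ys
∑₁-↭ f {xs} {ys} xs↭ys =
  ∑₁-sum f xs ⟨ trans ⟩ sum-↭ (↭ₚ.map⁺ f xs↭ys) ⟨ trans ⟩ sym (∑₁-sum f ys)

∑₁-length : ∀ (xs : List A) → ∑ 1 (λ _ → 1) xs ≡ length xs
∑₁-length []       = refl
∑₁-length (x ∷ xs) = cong suc (∑₁-length xs)

⟦_⟧ : Bool → ℕ
⟦ true  ⟧ = 1
⟦ false ⟧ = 0

⟦∧⟧ : ∀ x y → ⟦ x ∧ y ⟧ ≡ ⟦ x ⟧ * ⟦ y ⟧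
⟦∧⟧ true  y = sym (+-identityʳ ⟦ y ⟧)
⟦∧⟧ false y = refl

⟦∧⟧-* : ∀ x y g → ⟦ x ∧ y ⟧ * g ≡ ⟦ x ⟧ * (⟦ y ⟧ * g)
⟦∧⟧-* x y g = trans (cong (_* g) (⟦∧⟧ x y)) (*-assoc ⟦ x ⟧ ⟦ y ⟧ g)

⟦∧⟧-distrib : ∀ x y c d → ⟦ y ⟧ * (⟦ x ⟧ * c + d) ≡ ⟦ x ∧ y ⟧ * c + ⟦ y ⟧ * d
⟦∧⟧-distrib x y c d rewrite ⟦∧⟧ x y = distrib ⟦ x ⟧ ⟦ y ⟧ c d
  where
  distrib : ∀ x y c d → y * (x * c + d) ≡ x * y * c + y * d
  distrib = solve-∀

<ᵇ-true : ∀ {m n} → m < n → (m <ᵇ n) ≡ true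
<ᵇ-true {m} {n} m<n with m <ᵇ n | <ᵇ-reflects-< m n
... | true  | _          = refl
... | false | ofⁿ m≮n    = contradiction m<n m≮n

<ᵇ-false : ∀ {m n} → n ≤ m → (m <ᵇ n) ≡ false
<ᵇ-false {m} {n} n≤m with m <ᵇ n | <ᵇ-reflects-< m n
... | true  | ofʸ m<n = contradiction n≤m (<⇒≱ m<n)
... | false | _       = refl

b<≡<ᵇ : ∀ a b → b< a b ≡ (a <ᵇ b)
b<≡<ᵇ a b = isYes≗does (a <? b)

b≡≡≡ᵇ : ∀ a b → b≡ a b ≡ (a ≡ᵇ b)
b≡≡≡ᵇ a b = isYes≗does (a ≟ b)

b<-true : ∀ {a b} → a < b → b< a b ≡ true
b<-true {a} {b} a<b = trans (b<≡<ᵇ a b) (<ᵇ-true a<b)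

b<-false : ∀ {a b} → b ≤ a → b< a b ≡ false
b<-false {a} {b} b≤a = trans (b<≡<ᵇ a b) (<ᵇ-false b≤a)

Bounded : ℕ → ℕ → Set
Bounded m b = 1 ≤ b × b ≤ m

∑-upTo-suc : ∀ (f : ℕ → ℕ) m → ∑ 1 f (upTo (suc m)) ≡ f 0 + ∑ 1 (λ k → f (suc k)) (upTo m)
∑-upTo-suc f m = cong (λ ks → f 0 + ∑ 1 f ks) (sym (map-upTo suc m))
  ⟨ trans ⟩ cong (f 0 +_) (∑-map 1 f suc (upTo m))

∑-δ₀ : ∀ m b (f : ℕ → ℕ) →
  ∑ 1 (λ k → ⟦ b ≡ᵇ k ⟧ * f k) (upTo m) ≡ ⟦ b <ᵇ m ⟧ * f b
∑-δ₀ zero    b       f = refl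
∑-δ₀ (suc m) zero    f = begin
  ∑ 1 (λ k → ⟦ 0 ≡ᵇ k ⟧ * f k) (upTo (suc m)) ≡⟨ ∑-upTo-suc _ m ⟩
  1 * f 0 + ∑ 1 (λ _ → 0) (upTo m)          ≡⟨ cong (1 * f 0 +_) (∑₁-zero (upTo m)) ⟩
  1 * f 0 + 0                                ≡⟨ +-identityʳ _ ⟩
  1 * f 0 ∎
∑-δ₀ (suc m) (suc b) f =
  trans (∑-upTo-suc (λ k → ⟦ suc b ≡ᵇ k ⟧ * f k) m) (∑-δ₀ m b (λ k → f (suc k)))

∑-δ : ∀ {m b} → Bounded m b → (f : ℕ → ℕ) →
  ∑ 1 (λ k → ⟦ b ≡ᵇ k ⟧ * f k) (range1 m) ≡ f b
∑-δ {m} {suc b} (_ , b<m) f = begin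
  ∑ 1 (λ k → ⟦ suc b ≡ᵇ k ⟧ * f k) (range1 m) ≡⟨ ∑-map 1 _ suc (upTo m) ⟩
  ∑ 1 (λ k → ⟦ b ≡ᵇ k ⟧ * f (suc k)) (upTo m) ≡⟨ ∑-δ₀ m b (λ k → f (suc k)) ⟩
  ⟦ b <ᵇ m ⟧ * f (suc b)                      ≡⟨ cong (λ x → ⟦ x ⟧ * f (suc b)) (<ᵇ-true b<m) ⟩
  1 * f (suc b)                               ≡⟨ *-identityˡ _ ⟩
  f (suc b) ∎

∑-prefix₀ : ∀ {j m} (f : ℕ → ℕ) → j ≤ m →
  ∑ 1 (λ k → ⟦ k <ᵇ j ⟧ * f k) (upTo m) ≡ ∑ 1 f (upTo j)
∑-prefix₀ {zero}  {m}     f _         = ∑₁-zero (upTo m)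
∑-prefix₀ {suc j} {suc m} f (s≤s j≤m) = begin
  ∑ 1 (λ k → ⟦ k <ᵇ suc j ⟧ * f k) (upTo (suc m))
    ≡⟨ ∑-upTo-suc _ m ⟩
  1 * f 0 + ∑ 1 (λ k → ⟦ k <ᵇ j ⟧ * f (suc k)) (upTo m)
    ≡⟨ cong₂ _+_ (*-identityˡ (f 0)) (∑-prefix₀ _ j≤m) ⟩
  f 0 + ∑ 1 (λ k → f (suc k)) (upTo j)
    ≡⟨ ∑-upTo-suc f j ⟨
  ∑ 1 f (upTo (suc j)) ∎

∑-prefix : ∀ {j m} (f : ℕ → ℕ) → j ≤ m →
  ∑ 1 (λ k → ⟦ k <ᵇ suc j ⟧ * f k) (range1 m) ≡ ∑ 1 f (range1 j)
∑-prefix {j} {m} f j≤m = begin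
  ∑ 1 (λ k → ⟦ k <ᵇ suc j ⟧ * f k) (range1 m)      ≡⟨ ∑-map 1 _ suc (upTo m) ⟩
  ∑ 1 (λ k → ⟦ k <ᵇ j ⟧ * f (suc k)) (upTo m)      ≡⟨ ∑-prefix₀ _ j≤m ⟩
  ∑ 1 (λ k → f (suc k)) (upTo j)                   ≡⟨ ∑-map 1 f suc (upTo j) ⟨
  ∑ 1 f (range1 j) ∎

∑-below : ∀ {j m} → j ≤ m → ∑ 1 (λ k → ⟦ k <ᵇ suc j ⟧) (range1 m) ≡ j
∑-below {j} {m} j≤m = begin
  ∑ 1 (λ k → ⟦ k <ᵇ suc j ⟧) (range1 m)       ≡⟨ ∑-cong 1 (λ k → sym (*-identityʳ _)) (range1 m) ⟩
  ∑ 1 (λ k → ⟦ k <ᵇ suc j ⟧ * 1) (range1 m)   ≡⟨ ∑-prefix (λ _ → 1) j≤m ⟩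
  ∑ 1 (λ _ → 1) (range1 j)                    ≡⟨ ∑₁-length (range1 j) ⟩
  length (range1 j)                           ≡⟨ length-map suc (upTo j) ⟩
  length (upTo j)                             ≡⟨ length-upTo j ⟩
  j ∎

range1-sorted : ∀ m → AllPairs _<_ (range1 m)
range1-sorted m = AllPairsₚ.map⁺ (AllPairsₚ.applyUpTo⁺₁ id m (λ i<j _ → s<s i<j))

range1-bounded : ∀ m → All (Bounded m) (range1 m)
range1-bounded m = Allₚ.map⁺ (Allₚ.applyUpTo⁺₁ id m (λ k<m → s≤s z≤n , k<m))

range1-unique : ∀ m → Unique (range1 m)
range1-unique m = Uniqueₚ.map⁺ suc-injective (Uniqueₚ.upTo⁺ m)

-- Counting increasing tuples of positions

count-∑ : ∀ bs → count bs ≡ ∑ 1 ⟦_⟧ bs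
count-∑ []           = refl
count-∑ (true  ∷ bs) = cong suc (count-∑ bs)
count-∑ (false ∷ bs) = count-∑ bs

count-concatMap : ∀ (g : A → List Bool) xs → count (concatMap g xs) ≡ ∑ 1 (λ x → count (g x)) xs
count-concatMap g xs = begin
  count (concatMap g xs)            ≡⟨ count-∑ (concatMap g xs) ⟩
  ∑ 1 ⟦_⟧ (concatMap g xs)          ≡⟨ ∑₁-concatMap ⟦_⟧ g xs ⟩
  ∑ 1 (λ x → ∑ 1 ⟦_⟧ (g x)) xs      ≡⟨ ∑-cong 1 (λ x → sym (count-∑ (g x))) xs ⟩
  ∑ 1 (λ x → count (g x)) xs        ∎

count-map : ∀ (p : A → Bool) xs → count (map p xs) ≡ ∑ 1 (λ x → ⟦ p x ⟧) xs
count-map p xs = trans (count-∑ (map p xs)) (∑-map 1 ⟦_⟧ p xs)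

-- chainCount n ks lo g P counts the tuples a₁, …, aₙ of elements of ks satisfying
-- g (b< lo a₁ ∧ b< a₁ a₂ ∧ ⋯ ∧ P a₁ ⋯ aₙ); accumulating the tests inside g reproduces
-- literally the nesting of the conjunctions in count2, count3 and count4.
chainCount : ∀ n → List ℕ → ℕ → (Bool → Bool) → N-ary n ℕ Bool → ℕ
chainCount zero    ks lo g b = ⟦ g b ⟧
chainCount (suc n) ks lo g P = ∑ 1 (λ a → chainCount n ks a (λ r → g (b< lo a ∧ r)) (P a)) ks

chainCount-false : ∀ n ks lo {g} P → (∀ r → g r ≡ false) → chainCount n ks lo g P ≡ 0
chainCount-false zero    ks lo P g≡false = cong ⟦_⟧ (g≡false P)
chainCount-false (suc n) ks lo P g≡false = trans
  (∑-cong 1 (λ a → chainCount-false n ks a (P a) (λ r → g≡false _)) ks) (∑₁-zero ks)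

chainCount-drop : ∀ n x ks lo g P → x ≤ lo → g false ≡ false →
  chainCount n (x ∷ ks) lo g P ≡ chainCount n ks lo g P
chainCount-drop zero    x ks lo g P x≤lo g-false = refl
chainCount-drop (suc n) x ks lo g P x≤lo g-false = cong₂ _+_ x-term (∑-cong 1 drop-below ks)
  where
  x-term : chainCount n (x ∷ ks) x (λ r → g (b< lo x ∧ r)) (P x) ≡ 0
  x-term rewrite b<-false x≤lo = chainCount-false n (x ∷ ks) x (P x) (λ _ → g-false)
  drop-below : ∀ a → chainCount n (x ∷ ks) a (λ r → g (b< lo a ∧ r)) (P a)
                   ≡ chainCount n ks a (λ r → g (b< lo a ∧ r)) (P a)
  drop-below a with x ≤? a
  ... | yes x≤a = chainCount-drop n x ks a _ (P a) x≤a (trans (cong g (∧-zeroʳ (b< lo a))) g-false)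
  ... | no  x≰a rewrite b<-false (≤-trans (<⇒≤ (≰⇒> x≰a)) x≤lo) =
    trans (chainCount-false n (x ∷ ks) a (P a) (λ _ → g-false))
          (sym (chainCount-false n ks a (P a) (λ _ → g-false)))

chainCount-sorted : ∀ n {ks} lo g P → AllPairs _<_ ks → All (lo <_) ks → g false ≡ false →
  chainCount n ks lo g P ≡ ∑ n (mapⁿ n (λ b → ⟦ g b ⟧) P) ks
chainCount-sorted zero    lo g P _ _ _ = refl
chainCount-sorted (suc n) lo g P [] [] _ = refl
chainCount-sorted (suc n) {x ∷ ks} lo g P (x<ks ∷ sorted) (lo<x ∷ lo<ks) g-false
  rewrite b<-true lo<x = cong₂ _+_
    (trans (chainCount-drop n x ks x g (P x) ≤-refl g-false)
           (chainCount-sorted n x g (P x) sorted x<ks g-false))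
    (trans (∑-cong-local 1 (λ a x<a → chainCount-drop n x ks a _ (P a) (<⇒≤ x<a)
                                   (trans (cong g (∧-zeroʳ (b< lo a))) g-false)) x<ks)
           (chainCount-sorted (suc n) lo g P sorted lo<ks g-false))

∑-increasing : ∀ n {ks} P → AllPairs _<_ ks →
  ∑ 1 (λ a → chainCount n ks a id (P a)) ks ≡ ∑ (suc n) (mapⁿ (suc n) ⟦_⟧ P) ks
∑-increasing n P [] = refl
∑-increasing n {x ∷ ks} P (x<ks ∷ sorted) = cong₂ _+_
  (trans (chainCount-drop n x ks x id (P x) ≤-refl refl)
         (chainCount-sorted n x id (P x) sorted x<ks refl))
  (trans (∑-cong-local 1 (λ a x<a → chainCount-drop n x ks a id (P a) (<⇒≤ x<a) refl) x<ks)
         (∑-increasing n P sorted))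

count2-∑ : ∀ m P → count2 m P ≡ ∑ 2 (mapⁿ 2 ⟦_⟧ P) (range1 m)
count2-∑ m P = begin
  count2 m P
    ≡⟨ count-concatMap _ R ⟩
  ∑ 1 (λ a → count (map (λ b → b< a b ∧ P a b) R)) R
    ≡⟨ ∑-cong 1 (λ a → count-map _ R) R ⟩
  ∑ 1 (λ a → chainCount 1 R a id (P a)) R
    ≡⟨ ∑-increasing 1 P (range1-sorted m) ⟩
  ∑ 2 (mapⁿ 2 ⟦_⟧ P) R ∎
  where R = range1 m

count3-∑ : ∀ m P → count3 m P ≡ ∑ 3 (mapⁿ 3 ⟦_⟧ P) (range1 m)
count3-∑ m P = begin
  count3 m P
    ≡⟨ count-concatMap _ R ⟩
  ∑ 1 (λ a → count (concatMap (λ b → map (λ c → b< a b ∧ b< b c ∧ P a b c) R) R)) R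
    ≡⟨ ∑-cong 1 (λ a → trans (count-concatMap _ R) (∑-cong 1 (λ b → count-map _ R) R)) R ⟩
  ∑ 1 (λ a → chainCount 2 R a id (P a)) R
    ≡⟨ ∑-increasing 2 P (range1-sorted m) ⟩
  ∑ 3 (mapⁿ 3 ⟦_⟧ P) R ∎
  where R = range1 m

count4-∑ : ∀ m P → count4 m P ≡ ∑ 4 (mapⁿ 4 ⟦_⟧ P) (range1 m)
count4-∑ m P = begin
  count4 m P
    ≡⟨ count-concatMap _ R ⟩
  ∑ 1 (λ a → count (concatMap (λ b → concatMap (λ c → map (λ d →
          b< a b ∧ b< b c ∧ b< c d ∧ P a b c d) R) R) R)) R
    ≡⟨ ∑-cong 1 (λ a → trans (count-concatMap _ R) (∑-cong 1 (λ b →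
         trans (count-concatMap _ R) (∑-cong 1 (λ c → count-map _ R) R)) R)) R ⟩
  ∑ 1 (λ a → chainCount 3 R a id (P a)) R
    ≡⟨ ∑-increasing 3 P (range1-sorted m) ⟩
  ∑ 4 (mapⁿ 4 ⟦_⟧ P) R ∎
  where R = range1 m

applyUpTo-at : ∀ w → applyUpTo (λ k → at w (suc k)) (length w) ≡ w
applyUpTo-at []      = refl
applyUpTo-at (x ∷ w) = cong (x ∷_) (applyUpTo-at w)

map-at-range1 : ∀ w → map (at w) (range1 (length w)) ≡ w
map-at-range1 w = begin
  map (at w) (map suc (upTo (length w)))  ≡⟨ map-∘ (upTo (length w)) ⟨
  map (λ k → at w (suc k)) (upTo (length w)) ≡⟨ map-upTo _ (length w) ⟩
  applyUpTo (λ k → at w (suc k)) (length w) ≡⟨ applyUpTo-at w ⟩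
  w ∎

∑-positions : ∀ n F w → ∑ n (F ∘ⁿ at w) (range1 (length w)) ≡ ∑ n F w
∑-positions n F w = trans (sym (∑-map n F (at w) _)) (cong (∑ n F) (map-at-range1 w))

pattern1243 : ℕ → ℕ → ℕ → ℕ → Bool
pattern1243 a b c d = ⌊ ≡-dec _≟_ (red (a ∷ b ∷ c ∷ d ∷ [])) (1 ∷ 2 ∷ 4 ∷ 3 ∷ []) ⌋

xExp-∑ : ∀ w j → xExp (length w) w j ≡ ∑ 2 (λ a b → ⟦ b< b a ∧ b≡ b j ⟧) w
xExp-∑ w j = trans (count2-∑ (length w) _) (∑-positions 2 (λ a b → ⟦ b< b a ∧ b≡ b j ⟧) w)

yExp-∑ : ∀ w j → yExp (length w) w j ≡ ∑ 3 (λ a b c → ⟦ b≡ a j ∧ b< j c ∧ b< c b ⟧) w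
yExp-∑ w j =
  trans (count3-∑ (length w) _) (∑-positions 3 (λ a b c → ⟦ b≡ a j ∧ b< j c ∧ b< c b ⟧) w)

N1243-∑ : ∀ w → N1243 (length w) w ≡ ∑ 4 (λ a b c d → ⟦ pattern1243 a b c d ⟧) w
N1243-∑ w = trans (count4-∑ (length w) _) (∑-positions 4 (λ a b c d → ⟦ pattern1243 a b c d ⟧) w)

-- Degrees of monomials

deg : (Var → ℕ) → Monomial → ℕ
deg h = ∑ 1 h

_≟ᵥ_ : DecidableEquality Var
T   ≟ᵥ T   = yes refl
T   ≟ᵥ X _ = no λ ()
T   ≟ᵥ Y _ = no λ ()
X _ ≟ᵥ T   = no λ ()
X a ≟ᵥ X b = Decidable.map′ (cong X) (λ { refl → refl }) (a ≟ b)
X _ ≟ᵥ Y _ = no λ ()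
Y _ ≟ᵥ T   = no λ ()
Y _ ≟ᵥ X _ = no λ ()
Y a ≟ᵥ Y b = Decidable.map′ (cong Y) (λ { refl → refl }) (a ≟ b)

occurrences : Var → Var → ℕ
occurrences x y = ⟦ does (y ≟ᵥ x) ⟧

occurs⇒∈ : ∀ x v → 0 < deg (occurrences x) v → x ∈ v
occurs⇒∈ x (y ∷ v) pos with y ≟ᵥ x
... | yes refl = here refl
... | no  _    = there (occurs⇒∈ x v pos)

occurs-head : ∀ x u → 0 < deg (occurrences x) (x ∷ u)
occurs-head x u with x ≟ᵥ x
... | yes _  = s≤s z≤n
... | no x≢x = contradiction refl x≢x

deg≗⇒↭ : ∀ (u v : Monomial) → (∀ h → deg h u ≡ deg h v) → u ↭ v
deg≗⇒↭ []      []      _      = ↭-refl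
deg≗⇒↭ []      (y ∷ v) deg-eq = contradiction (deg-eq (λ _ → 1)) (λ ())
deg≗⇒↭ (x ∷ u) v       deg-eq
  with as , bs , refl ← ∈-∃++ (occurs⇒∈ x v (subst (0 <_) (deg-eq _) (occurs-head x u)))
  = ↭-trans (↭-prep x (deg≗⇒↭ u (as ++ bs) λ h →
              +-cancelˡ-≡ (h x) _ _ (trans (deg-eq h) (∑₁-↭ h (shift x as bs)))))
            (↭-sym (shift x as bs))

∑-xExp : ∀ w (g : ℕ → ℕ) → All (Bounded (length w)) w →
  ∑ 1 (λ k → xExp (length w) w k * g k) (range1 (length w)) ≡ ∑ 2 (λ a b → ⟦ b <ᵇ a ⟧ * g b) w
∑-xExp w g bounded = begin
  ∑ 1 (λ k → xExp (length w) w k * g k) R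
    ≡⟨ ∑-cong 1 (λ k → trans (cong (_* g k) (xExp-∑ w k)) (sym (∑-*ʳ 2 _ (g k) w))) R ⟩
  ∑ 1 (λ k → ∑ 2 (λ a b → ⟦ b< b a ∧ b≡ b k ⟧ * g k) w) R
    ≡⟨ ∑-comm 2 _ R w ⟩
  ∑ 2 (λ a b → ∑ 1 (λ k → ⟦ b< b a ∧ b≡ b k ⟧ * g k) R) w
    ≡⟨ ∑-cong-local 2 (λ a _ b b-bounded → collapse a b b-bounded) bounded ⟩
  ∑ 2 (λ a b → ⟦ b <ᵇ a ⟧ * g b) w ∎
  where
  R = range1 (length w)
  collapse : ∀ a b → Bounded (length w) b →
    ∑ 1 (λ k → ⟦ b< b a ∧ b≡ b k ⟧ * g k) R ≡ ⟦ b <ᵇ a ⟧ * g b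
  collapse a b b-bounded = trans (∑-cong 1 swap R) (∑-δ b-bounded (λ k → ⟦ b <ᵇ a ⟧ * g k))
    where
    swap : ∀ k → ⟦ b< b a ∧ b≡ b k ⟧ * g k ≡ ⟦ b ≡ᵇ k ⟧ * (⟦ b <ᵇ a ⟧ * g k)
    swap k rewrite b<≡<ᵇ b a | b≡≡≡ᵇ b k | ∧-comm (b <ᵇ a) (b ≡ᵇ k) =
      ⟦∧⟧-* (b ≡ᵇ k) (b <ᵇ a) (g k)

∑-yExp : ∀ w (g : ℕ → ℕ) → All (Bounded (length w)) w →
  ∑ 1 (λ k → yExp (length w) w k * g k) (range1 (length w))
    ≡ ∑ 3 (λ a b c → ⟦ (a <ᵇ c) ∧ (c <ᵇ b) ⟧ * g a) w
∑-yExp w g bounded = begin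
  ∑ 1 (λ k → yExp (length w) w k * g k) R
    ≡⟨ ∑-cong 1 (λ k → trans (cong (_* g k) (yExp-∑ w k)) (sym (∑-*ʳ 3 _ (g k) w))) R ⟩
  ∑ 1 (λ k → ∑ 3 (λ a b c → ⟦ b≡ a k ∧ b< k c ∧ b< c b ⟧ * g k) w) R
    ≡⟨ ∑-comm 3 _ R w ⟩
  ∑ 3 (λ a b c → ∑ 1 (λ k → ⟦ b≡ a k ∧ b< k c ∧ b< c b ⟧ * g k) R) w
    ≡⟨ ∑-cong-local 3 (λ a a-bounded b _ c _ → collapse a b c a-bounded) bounded ⟩
  ∑ 3 (λ a b c → ⟦ (a <ᵇ c) ∧ (c <ᵇ b) ⟧ * g a) w ∎
  where
  R = range1 (length w)
  collapse : ∀ a b c → Bounded (length w) a →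
    ∑ 1 (λ k → ⟦ b≡ a k ∧ b< k c ∧ b< c b ⟧ * g k) R ≡ ⟦ (a <ᵇ c) ∧ (c <ᵇ b) ⟧ * g a
  collapse a b c a-bounded =
    trans (∑-cong 1 assoc R) (∑-δ a-bounded (λ k → ⟦ (k <ᵇ c) ∧ (c <ᵇ b) ⟧ * g k))
    where
    assoc : ∀ k →
      ⟦ b≡ a k ∧ b< k c ∧ b< c b ⟧ * g k ≡ ⟦ a ≡ᵇ k ⟧ * (⟦ (k <ᵇ c) ∧ (c <ᵇ b) ⟧ * g k)
    assoc k rewrite b≡≡≡ᵇ a k | b<≡<ᵇ k c | b<≡<ᵇ c b = ⟦∧⟧-* (a ≡ᵇ k) _ (g k)

deg-weight : ∀ {m} w → All (Bounded m) w → length w ≡ m → ∀ h →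
  deg h (weight m w)
    ≡ ∑ 4 (λ a b c d → ⟦ pattern1243 a b c d ⟧) w * h T
      + (∑ 2 (λ a b → ⟦ b <ᵇ a ⟧ * h (X b)) w
         + ∑ 3 (λ a b c → ⟦ (a <ᵇ c) ∧ (c <ᵇ b) ⟧ * h (Y a)) w)
deg-weight w bounded refl h = begin
  deg h (replicate (N1243 m w) T ++ concatMap block R)
    ≡⟨ ∑₁-++ h (replicate (N1243 m w) T) _ ⟩
  deg h (replicate (N1243 m w) T) + deg h (concatMap block R)
    ≡⟨ cong₂ _+_ (∑₁-replicate h (N1243 m w) T) (∑₁-concatMap h block R) ⟩
  N1243 m w * h T + ∑ 1 (λ k → deg h (block k)) R
    ≡⟨ cong (N1243 m w * h T +_) (∑-cong 1 deg-block R) ⟩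
  N1243 m w * h T + ∑ 1 (λ k → xExp m w k * h (X k) + yExp m w k * h (Y k)) R
    ≡⟨ cong (N1243 m w * h T +_) (∑-+ 1 _ _ R) ⟩
  N1243 m w * h T + (∑ 1 (λ k → xExp m w k * h (X k)) R + ∑ 1 (λ k → yExp m w k * h (Y k)) R)
    ≡⟨ cong₂ _+_ (cong (_* h T) (N1243-∑ w))
                 (cong₂ _+_ (∑-xExp w (λ k → h (X k)) bounded) (∑-yExp w (λ k → h (Y k)) bounded)) ⟩
  ∑ 4 (λ a b c d → ⟦ pattern1243 a b c d ⟧) w * h T
    + (∑ 2 (λ a b → ⟦ b <ᵇ a ⟧ * h (X b)) w
       + ∑ 3 (λ a b c → ⟦ (a <ᵇ c) ∧ (c <ᵇ b) ⟧ * h (Y a)) w) ∎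
  where
  m = length w
  R = range1 m
  block : ℕ → Monomial
  block k = replicate (xExp m w k) (X k) ++ replicate (yExp m w k) (Y k)
  deg-block : ∀ k → deg h (block k) ≡ xExp m w k * h (X k) + yExp m w k * h (Y k)
  deg-block k = trans (∑₁-++ h (replicate (xExp m w k) (X k)) _)
                      (cong₂ _+_ (∑₁-replicate h (xExp m w k) (X k)) (∑₁-replicate h (yExp m w k) (Y k)))

-- The pattern 1243

rank : List ℕ → ℕ → ℕ
rank w v = suc (length (filter (λ u → u <? v) w))

rank-∑ : ∀ w v → rank w v ≡ suc (∑ 1 (λ u → ⟦ u <ᵇ v ⟧) w)
rank-∑ []      v = refl
rank-∑ (x ∷ w) v with x <ᵇ v
... | true  = cong suc (rank-∑ w v)
... | false = rank-∑ w v

rank-mono : ∀ w {u v} → u ≤ v → rank w u ≤ rank w v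
rank-mono w {u} {v} u≤v = subst₂ _≤_ (sym (rank-∑ w u)) (sym (rank-∑ w v)) (s≤s (below-mono w))
  where
  below-mono : ∀ w → ∑ 1 (λ x → ⟦ x <ᵇ u ⟧) w ≤ ∑ 1 (λ x → ⟦ x <ᵇ v ⟧) w
  below-mono []      = z≤n
  below-mono (x ∷ w) with x <ᵇ u | <ᵇ-reflects-< x u
  ... | true  | ofʸ x<u rewrite <ᵇ-true (<-≤-trans x<u u≤v) = s≤s (below-mono w)
  ... | false | _       = ≤-trans (below-mono w) (m≤n+m _ ⟦ x <ᵇ v ⟧)

rank-<⁻¹ : ∀ w {u v} → rank w u < rank w v → u < v
rank-<⁻¹ w {u} {v} ru<rv with u <? v
... | yes u<v = u<v
... | no  u≮v = contradiction (rank-mono w (≮⇒≥ u≮v)) (<⇒≱ ru<rv)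

red≡1243⇔ : ∀ a b c d →
  red (a ∷ b ∷ c ∷ d ∷ []) ≡ 1 ∷ 2 ∷ 4 ∷ 3 ∷ [] ⇔ (a < b × b < d × d < c)
red≡1243⇔ a b c d = mk⇔ ordered ranks
  where
  l = a ∷ b ∷ c ∷ d ∷ []
  ordered : map (rank l) l ≡ 1 ∷ 2 ∷ 4 ∷ 3 ∷ [] → a < b × b < d × d < c
  ordered eq = rank-<⁻¹ l (subst₂ _<_ (sym ra) (sym rb) ≤-refl)
             , rank-<⁻¹ l (subst₂ _<_ (sym rb) (sym rd) ≤-refl)
             , rank-<⁻¹ l (subst₂ _<_ (sym rd) (sym rc) ≤-refl)
    where
    ra = ∷-injectiveˡ eq
    rb = ∷-injectiveˡ (∷-injectiveʳ eq)
    rc = ∷-injectiveˡ (∷-injectiveʳ (∷-injectiveʳ eq))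
    rd = ∷-injectiveˡ (∷-injectiveʳ (∷-injectiveʳ (∷-injectiveʳ eq)))
  ranks : a < b × b < d × d < c → map (rank l) l ≡ 1 ∷ 2 ∷ 4 ∷ 3 ∷ []
  ranks (a<b , b<d , d<c) = counted a<b b<d d<c (<-trans a<b b<d) (<-trans b<d d<c) (<-trans (<-trans a<b b<d) d<c)
    where
    counted : a < b → b < d → d < c → a < d → b < c → a < c → map (rank l) l ≡ 1 ∷ 2 ∷ 4 ∷ 3 ∷ []
    counted a<b b<d d<c a<d b<c a<c rewrite rank-∑ l a | rank-∑ l b | rank-∑ l c | rank-∑ l d
      | <ᵇ-false (≤-refl {a}) | <ᵇ-false (≤-refl {b}) | <ᵇ-false (≤-refl {c}) | <ᵇ-false (≤-refl {d})
      | <ᵇ-true a<b | <ᵇ-true a<d | <ᵇ-true a<c | <ᵇ-true b<d | <ᵇ-true b<c | <ᵇ-true d<c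
      | <ᵇ-false (<⇒≤ a<b) | <ᵇ-false (<⇒≤ a<d) | <ᵇ-false (<⇒≤ a<c)
      | <ᵇ-false (<⇒≤ b<d) | <ᵇ-false (<⇒≤ b<c) | <ᵇ-false (<⇒≤ d<c) = refl

isYes-≡ : ∀ {P : Set} (P? : Dec P) {x} → (P → x ≡ true) → (x ≡ true → P) → ⌊ P? ⌋ ≡ x
isYes-≡ (yes p) p⇒x _ = sym (p⇒x p)
isYes-≡ (no ¬p) {true}  _ x⇒p = contradiction (x⇒p refl) ¬p
isYes-≡ (no ¬p) {false} _ _   = refl

<ᵇ-chain⇔ : ∀ a b c d → (a < b × b < d × d < c) ⇔ ((a <ᵇ b) ∧ (b <ᵇ d) ∧ (d <ᵇ c) ≡ true)
<ᵇ-chain⇔ a b c d with a <ᵇ b | <ᵇ-reflects-< a b | b <ᵇ d | <ᵇ-reflects-< b d | d <ᵇ c | <ᵇ-reflects-< d c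
... | true  | ofʸ a<b | true  | ofʸ b<d | true  | ofʸ d<c = mk⇔ (λ _ → refl) (λ _ → a<b , b<d , d<c)
... | false | ofⁿ a≮b | _     | _       | _     | _       = mk⇔ (λ (a<b , _) → contradiction a<b a≮b) λ ()
... | true  | _       | false | ofⁿ b≮d | _     | _       = mk⇔ (λ (_ , b<d , _) → contradiction b<d b≮d) λ ()
... | true  | _       | true  | _       | false | ofⁿ d≮c = mk⇔ (λ (_ , _ , d<c) → contradiction d<c d≮c) λ ()

pattern1243≡ : ∀ a b c d → pattern1243 a b c d ≡ (a <ᵇ b) ∧ (b <ᵇ d) ∧ (d <ᵇ c)
pattern1243≡ a b c d = isYes-≡ (≡-dec _≟_ (red (a ∷ b ∷ c ∷ d ∷ [])) (1 ∷ 2 ∷ 4 ∷ 3 ∷ []))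
  (to (<ᵇ-chain⇔ a b c d) ∘ to (red≡1243⇔ a b c d))
  (from (red≡1243⇔ a b c d) ∘ from (<ᵇ-chain⇔ a b c d))
  where open Equivalence

-- Removing the first entry

skip : ℕ → ℕ → ℕ
skip i v = if i ≤ᵇ v then suc v else v

<ᵇ-skip : ∀ i a b → (skip i a <ᵇ skip i b) ≡ (a <ᵇ b)
<ᵇ-skip i a b with i ≤ᵇ a | ≤ᵇ-reflects-≤ i a | i ≤ᵇ b | ≤ᵇ-reflects-≤ i b
... | true  | _       | true  | _       = refl
... | false | _       | false | _       = refl
... | true  | ofʸ i≤a | false | ofⁿ i≰b = trans (<ᵇ-false (m≤n⇒m≤1+n b≤a)) (sym (<ᵇ-false b≤a))
  where b≤a = ≤-trans (<⇒≤ (≰⇒> i≰b)) i≤a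
... | false | ofⁿ i≰a | true  | ofʸ i≤b = trans (<ᵇ-true (m≤n⇒m≤1+n a<b)) (sym (<ᵇ-true a<b))
  where a<b = <-≤-trans (≰⇒> i≰a) i≤b

<ᵇ-skip-self : ∀ i b → (i <ᵇ skip i b) ≡ (i ≤ᵇ b)
<ᵇ-skip-self i b with i ≤ᵇ b | ≤ᵇ-reflects-≤ i b
... | true  | ofʸ i≤b = <ᵇ-true (s≤s i≤b)
... | false | ofⁿ i≰b = <ᵇ-false (<⇒≤ (≰⇒> i≰b))

pattern1243-skip : ∀ i a b c d →
  pattern1243 (skip i a) (skip i b) (skip i c) (skip i d) ≡ pattern1243 a b c d
pattern1243-skip i a b c d = begin
  pattern1243 (skip i a) (skip i b) (skip i c) (skip i d)
    ≡⟨ pattern1243≡ (skip i a) (skip i b) (skip i c) (skip i d) ⟩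
  (skip i a <ᵇ skip i b) ∧ (skip i b <ᵇ skip i d) ∧ (skip i d <ᵇ skip i c)
    ≡⟨ cong₂ _∧_ (<ᵇ-skip i a b) (cong₂ _∧_ (<ᵇ-skip i b d) (<ᵇ-skip i d c)) ⟩
  (a <ᵇ b) ∧ (b <ᵇ d) ∧ (d <ᵇ c)
    ≡⟨ pattern1243≡ a b c d ⟨
  pattern1243 a b c d ∎

pattern1243-skip-head : ∀ i b c d →
  pattern1243 i (skip i b) (skip i c) (skip i d) ≡ (i ≤ᵇ b) ∧ (b <ᵇ d) ∧ (d <ᵇ c)
pattern1243-skip-head i b c d = trans (pattern1243≡ i (skip i b) (skip i c) (skip i d))
  (cong₂ _∧_ (<ᵇ-skip-self i b) (cong₂ _∧_ (<ᵇ-skip i b d) (<ᵇ-skip i d c)))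

skip-above : ∀ {i x} → i ≤ x → skip i x ≡ suc x
skip-above {i} {x} i≤x with i ≤ᵇ x | ≤ᵇ-reflects-≤ i x
... | true  | _       = refl
... | false | ofⁿ i≰x = contradiction i≤x i≰x

skip-below : ∀ {i x} → x < i → skip i x ≡ x
skip-below {i} {x} x<i with i ≤ᵇ x | ≤ᵇ-reflects-≤ i x
... | true  | ofʸ i≤x = contradiction x<i (≤⇒≯ i≤x)
... | false | _       = refl

skip-rank : ∀ i j c → i ≢ suc j → ⟦ i <ᵇ suc j ⟧ + c ≡ j → skip i (suc c) ≡ suc j
skip-rank i j c i≢v counted with i <ᵇ suc j | <ᵇ-reflects-< i (suc j)
... | true  | ofʸ i<v rewrite sym counted = skip-above (≤-pred i<v)
... | false | ofⁿ i≮v rewrite sym counted = skip-below (≤∧≢⇒< (≮⇒≥ i≮v) (i≢v ∘ sym))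

red-bounded : ∀ w → All (Bounded (length w)) (red w)
red-bounded w = Allₚ.map⁺ (All.tabulate λ v∈w →
  s≤s z≤n , filter-notAll (λ u → u <? _) w (Any.map (λ { refl → <-irrefl refl }) v∈w))

module _ {m i rest} (perm : IsPerm (suc m) (i ∷ rest)) where

  perm-bounded : All (Bounded (suc m)) (i ∷ rest)
  perm-bounded = ↭ₚ.All-resp-↭ (↭-sym perm) (range1-bounded (suc m))

  perm-length : length rest ≡ m
  perm-length = suc-injective
    (↭ₚ.↭-length perm ⟨ trans ⟩ length-map suc (upTo (suc m)) ⟨ trans ⟩ length-upTo (suc m))

  perm-distinct : All (i ≢_) rest
  perm-distinct
    with i≢rest ∷ _ ← PermSetoid.Unique-resp-↭ (↭⇒↭ₛ (↭-sym perm)) (range1-unique (suc m))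
    = i≢rest

  red-tail : rest ≡ map (skip i) (red rest)
  red-tail = trans
    (sym (map-id-local (All.zipWith skip-rank-entry (All.tail perm-bounded , perm-distinct))))
    (map-∘ rest)
    where
    skip-rank-entry : ∀ {v} → Bounded (suc m) v × i ≢ v → skip i (rank rest v) ≡ v
    skip-rank-entry {suc j} ((_ , v≤n) , i≢v) = trans (cong (skip i) (rank-∑ rest (suc j)))
      (skip-rank i j _ i≢v
        (∑₁-↭ (λ u → ⟦ u <ᵇ suc j ⟧) perm ⟨ trans ⟩ ∑-below (≤-trans (n≤1+n j) v≤n)))

∑-before-head : ∀ {i n rest} (f : ℕ → ℕ) → i ∷ rest ↭ range1 n → Bounded n i →
  ∑ 1 (λ b → ⟦ b <ᵇ i ⟧ * f b) rest ≡ ∑ 1 f (range1 (i ∸ 1))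
∑-before-head {suc j} {n} {rest} f perm (_ , i≤n) = begin
  ∑ 1 g rest            ≡⟨ cong (λ x → ⟦ x ⟧ * f (suc j) + ∑ 1 g rest) (<ᵇ-false (≤-refl {j})) ⟨
  ∑ 1 g (suc j ∷ rest)  ≡⟨ ∑₁-↭ g perm ⟩
  ∑ 1 g (range1 n)      ≡⟨ ∑-prefix f (≤-trans (n≤1+n j) i≤n) ⟩
  ∑ 1 f (range1 j)      ∎
  where g = λ b → ⟦ b <ᵇ suc j ⟧ * f b

-- The substitution A

inRange-≤ : ∀ {b m} i → b ≤ m → inRange (suc m) i b ≡ (i ≤ᵇ b)
inRange-≤ {b} {m} i b≤m = begin
  ⌊ i ≤? b ⌋ ∧ ⌊ b ≤? m ⌋
    ≡⟨ cong₂ _∧_ (isYes≗does (i ≤? b))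
                 (trans (isYes≗does (b ≤? m)) (Decidable.dec-true (b ≤? m) b≤m)) ⟩
  (i ≤ᵇ b) ∧ true
    ≡⟨ ∧-identityʳ (i ≤ᵇ b) ⟩
  i ≤ᵇ b ∎

deg-substA-X : ∀ {b m} i h → b ≤ m →
  deg h (substA (suc m) i (X b)) ≡ ⟦ i ≤ᵇ b ⟧ * h (Y i) + h (X (skip i b))
deg-substA-X {b} i h b≤m rewrite inRange-≤ i b≤m with i ≤ᵇ b
... | true  = trans (cong (h (Y i) +_) (+-identityʳ _)) (cong (_+ h (X (suc b))) (sym (*-identityˡ (h (Y i)))))
... | false = +-identityʳ (h (X b))

deg-substA-Y : ∀ {b m} i h → b ≤ m →
  deg h (substA (suc m) i (Y b)) ≡ ⟦ i ≤ᵇ b ⟧ * h T + h (Y (skip i b))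
deg-substA-Y {b} i h b≤m rewrite inRange-≤ i b≤m with i ≤ᵇ b
... | true  = trans (cong (h T +_) (+-identityʳ _)) (cong (_+ h (Y (suc b))) (sym (*-identityˡ (h T))))
... | false = +-identityʳ (h (Y b))

module _ {m i rest} (perm : IsPerm (suc m) (i ∷ rest)) (h : Var → ℕ) where
  private
    σ = red rest
    s = skip i

    σ-bounded : All (Bounded m) σ
    σ-bounded = subst (λ k → All (Bounded k) σ) (perm-length perm) (red-bounded rest)

    on-σ : ∀ n F → ∑ n F rest ≡ ∑ n (F ∘ⁿ s) σ
    on-σ n F = trans (cong (∑ n F) (red-tail perm)) (∑-map n F s σ)

    -- N and T₃ count the occurrences of 1243 in π avoiding and starting at π₁ = i, Y₂ the
    -- triples (i, b, c) giving a y_i, and L the inversions (i, b); X₂ and Y₃ are the x- and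
    -- y-contributions of the subsequences avoiding π₁.
    N T₃ Y₂ X₂ Y₃ L : ℕ
    N  = ∑ 4 (λ a b c d → ⟦ pattern1243 a b c d ⟧) σ
    T₃ = ∑ 3 (λ a b c → ⟦ (i ≤ᵇ a) ∧ (a <ᵇ c) ∧ (c <ᵇ b) ⟧) σ
    Y₂ = ∑ 2 (λ a b → ⟦ (i ≤ᵇ b) ∧ (b <ᵇ a) ⟧) σ
    X₂ = ∑ 2 (λ a b → ⟦ b <ᵇ a ⟧ * h (X (s b))) σ
    Y₃ = ∑ 3 (λ a b c → ⟦ (a <ᵇ c) ∧ (c <ᵇ b) ⟧ * h (Y (s a))) σ
    L  = ∑ 1 (λ b → h (X b)) (range1 (i ∸ 1))

  deg-lhs : deg h (weight (suc m) (i ∷ rest)) ≡ (T₃ + N) * h T + ((L + X₂) + (Y₂ * h (Y i) + Y₃))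
  deg-lhs = begin
    deg h (weight (suc m) (i ∷ rest))
      ≡⟨ deg-weight (i ∷ rest) (perm-bounded perm) (cong suc (perm-length perm)) h ⟩
    (∑ 3 (λ b c d → ⟦ pattern1243 i b c d ⟧) rest
     + ∑ 4 (λ a b c d → ⟦ pattern1243 a b c d ⟧) rest) * h T
      + ((∑ 1 (λ b → ⟦ b <ᵇ i ⟧ * h (X b)) rest + ∑ 2 (λ a b → ⟦ b <ᵇ a ⟧ * h (X b)) rest)
         + (∑ 2 (λ b c → ⟦ (i <ᵇ c) ∧ (c <ᵇ b) ⟧ * h (Y i)) rest
            + ∑ 3 (λ a b c → ⟦ (a <ᵇ c) ∧ (c <ᵇ b) ⟧ * h (Y a)) rest))
      ≡⟨ cong₂ (λ u v → u * h T + v)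
               (cong₂ _+_ starting-at-i patterns)
               (cong₂ _+_ (cong₂ _+_ below-i inversions) (cong₂ _+_ y-pairs y-triples)) ⟩
    (T₃ + N) * h T + ((L + X₂) + (Y₂ * h (Y i) + Y₃)) ∎
    where
    starting-at-i : ∑ 3 (λ b c d → ⟦ pattern1243 i b c d ⟧) rest ≡ T₃
    starting-at-i = trans (on-σ 3 _) (∑-cong 3 (λ a b c → cong ⟦_⟧ (pattern1243-skip-head i a b c)) σ)
    patterns : ∑ 4 (λ a b c d → ⟦ pattern1243 a b c d ⟧) rest ≡ N
    patterns = trans (on-σ 4 _) (∑-cong 4 (λ a b c d → cong ⟦_⟧ (pattern1243-skip i a b c d)) σ)
    below-i : ∑ 1 (λ b → ⟦ b <ᵇ i ⟧ * h (X b)) rest ≡ L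
    below-i = ∑-before-head (λ b → h (X b)) perm (All.head (perm-bounded perm))
    inversions : ∑ 2 (λ a b → ⟦ b <ᵇ a ⟧ * h (X b)) rest ≡ X₂
    inversions = trans (on-σ 2 _)
      (∑-cong 2 (λ a b → cong (λ x → ⟦ x ⟧ * h (X (s b))) (<ᵇ-skip i b a)) σ)
    y-pairs : ∑ 2 (λ b c → ⟦ (i <ᵇ c) ∧ (c <ᵇ b) ⟧ * h (Y i)) rest ≡ Y₂ * h (Y i)
    y-pairs = on-σ 2 _
      ⟨ trans ⟩ ∑-cong 2 (λ b c → cong (λ x → ⟦ x ⟧ * h (Y i))
                                       (cong₂ _∧_ (<ᵇ-skip-self i c) (<ᵇ-skip i c b))) σ
      ⟨ trans ⟩ ∑-*ʳ 2 _ (h (Y i)) σ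
    y-triples : ∑ 3 (λ a b c → ⟦ (a <ᵇ c) ∧ (c <ᵇ b) ⟧ * h (Y a)) rest ≡ Y₃
    y-triples = trans (on-σ 3 _)
      (∑-cong 3 (λ a b c → cong (λ x → ⟦ x ⟧ * h (Y (s a)))
                                (cong₂ _∧_ (<ᵇ-skip i a c) (<ᵇ-skip i c b))) σ)

  deg-rhs : deg h (map X (range1 (i ∸ 1)) ++ applySubst (substA (suc m) i) (weight m σ))
            ≡ L + (N * h T + ((Y₂ * h (Y i) + X₂) + (T₃ * h T + Y₃)))
  deg-rhs = begin
    deg h (map X (range1 (i ∸ 1)) ++ concatMap subst-A (weight m σ))
      ≡⟨ ∑₁-++ h (map X (range1 (i ∸ 1))) _ ⟩
    deg h (map X (range1 (i ∸ 1))) + deg h (concatMap subst-A (weight m σ))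
      ≡⟨ cong₂ _+_ (∑-map 1 h X (range1 (i ∸ 1))) (∑₁-concatMap h subst-A (weight m σ)) ⟩
    L + deg hA (weight m σ)
      ≡⟨ cong (L +_) (deg-weight σ σ-bounded (trans (length-map _ rest) (perm-length perm)) hA) ⟩
    L + (N * hA T + (∑ 2 (λ a b → ⟦ b <ᵇ a ⟧ * hA (X b)) σ
                     + ∑ 3 (λ a b c → ⟦ (a <ᵇ c) ∧ (c <ᵇ b) ⟧ * hA (Y a)) σ))
      ≡⟨ cong (L +_) (cong₂ _+_ (cong (N *_) (+-identityʳ (h T))) (cong₂ _+_ x-part y-part)) ⟩
    L + (N * h T + ((Y₂ * h (Y i) + X₂) + (T₃ * h T + Y₃))) ∎
    where
    subst-A = substA (suc m) i
    hA = λ u → deg h (subst-A u)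
    x-part : ∑ 2 (λ a b → ⟦ b <ᵇ a ⟧ * hA (X b)) σ ≡ Y₂ * h (Y i) + X₂
    x-part = ∑-cong-local 2 (λ a _ b (_ , b≤m) →
               trans (cong (⟦ b <ᵇ a ⟧ *_) (deg-substA-X i h b≤m))
                     (⟦∧⟧-distrib (i ≤ᵇ b) (b <ᵇ a) (h (Y i)) (h (X (s b))))) σ-bounded
      ⟨ trans ⟩ ∑-+ 2 _ _ σ ⟨ trans ⟩ cong (_+ X₂) (∑-*ʳ 2 _ (h (Y i)) σ)
    y-part : ∑ 3 (λ a b c → ⟦ (a <ᵇ c) ∧ (c <ᵇ b) ⟧ * hA (Y a)) σ ≡ T₃ * h T + Y₃
    y-part = ∑-cong-local 3 (λ a (_ , a≤m) b _ c _ →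
               trans (cong (⟦ (a <ᵇ c) ∧ (c <ᵇ b) ⟧ *_) (deg-substA-Y i h a≤m))
                     (⟦∧⟧-distrib (i ≤ᵇ a) ((a <ᵇ c) ∧ (c <ᵇ b)) (h T) (h (Y (s a))))) σ-bounded
      ⟨ trans ⟩ ∑-+ 3 _ _ σ ⟨ trans ⟩ cong (_+ Y₃) (∑-*ʳ 3 _ (h T) σ)

  weight-degrees-agree : deg h (weight (suc m) (i ∷ rest))
                         ≡ deg h (map X (range1 (i ∸ 1)) ++ applySubst (substA (suc m) i) (weight m σ))
  weight-degrees-agree = trans deg-lhs (trans (rearrange T₃ N L X₂ Y₂ (h T) (h (Y i)) Y₃) (sym deg-rhs))
    where
    rearrange : ∀ t n l x y hT hY y₃ →
      (t + n) * hT + ((l + x) + (y * hY + y₃)) ≡ l + (n * hT + ((y * hY + x) + (t * hT + y₃)))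
    rearrange = solve-∀

mainTheorem3 : (n i : ℕ) (rest : List ℕ) → 1 ≤ n → IsPerm n (i ∷ rest) →
    weight n (i ∷ rest) ↭ (map X (range1 (i ∸ 1)) ++ applySubst (substA n i) (weight (n ∸ 1) (red rest)))
mainTheorem3 (suc m) i rest _ perm = deg≗⇒↭ _ _ (weight-degrees-agree perm)
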